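{- Let $b > 1$ be an integer and let $S$ be a numerical monoid with minimal system of generators $\{n_1,\dots,n_p\}$. Then $S$ is a $b$-LD-semigroup if and only if $s - \{0,1,\dots,P(s)-1\} \subseteq S$ for all $s \in S\setminus\{0\}$, where $s - \{0,\dots,P(s)-1\} = \{s-j : 0 \le j \le P(s)-1\}$.
   Context: $\mathbb{N}=\{0,1,2,\dots\}$. A numerical monoid is a submonoid of $(\mathbb{N},+)$ with finite complement in $\mathbb{N}$; its minimal system of generators $\{n_1,\dots,n_p\}$ is unique. For $s \in S$ put $P(s) := \max\{c_1+\cdots+c_p : c_1,\dots,c_p \in \mathbb{N},\ s = c_1 n_1 + \cdots + c_p n_p\}$. For $b>1$: every positive integer $z$ has a unique representation $z=\sum_{i=0}^{n} u_i b^i$ with $u_i \in \{0,\dots,b-1\}$, $u_n\neq 0$; its length is $\ell_b(z):=n+1$. A $b$-digital semigroup is a nonempty subsemigroup $D$ of $(\mathbb{N}\setminus\{0\},\cdot)$ such that for every $d \in D$, every positive integer $z$ with $\ell_b(z)=\ell_b(d)$ lies in $D$. A submonoid $S$ of $(\mathbb{N},+)$ is a $b$-LD-semigroup if there is a $b$-digital semigroup $D$ with $S = \{\ell_b(d) : d \in D\}\cup\{0\}$. -}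

module Defs where

open import Level using (0ℓ)
open import Data.Nat using (ℕ; zero; suc; _+_; _*_; _≤_; _<_; NonZero)
open import Data.Nat.DivMod using (_/_)
open import Data.Fin using (Fin)
open import Data.Vec using (Vec; zipWith; sum; lookup)
open import Data.Product using (Σ; ∃; _×_; _,_)
open import Data.Sum using (_⊎_)
open import Relation.Nullary using (¬_)
open import Relation.Binary.PropositionalEquality using (_≡_)
open import Function.Bundles using (_⇔_)

Subset : Set₁
Subset = ℕ → Set

record IsNumericalMonoid (S : Subset) : Set where
  field
    has-zero   : S 0
    closed-+   : ∀ {x y} → S x → S y → S (x + y)
    cofinite   : ∃ λ N → ∀ n → N ≤ n → S n

value : ∀ {p} → Vec ℕ p → Vec ℕ p → ℕ
value c gens = sum (zipWith _*_ c gens)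

len : ∀ {p} → Vec ℕ p → ℕ
len c = sum c

Generated : ∀ {p} → Vec ℕ p → ℕ → Set
Generated {p} gens s = Σ (Vec ℕ p) λ c → s ≡ value c gens

record IsMinimalSystemOfGenerators (S : Subset) {p : ℕ} (gens : Vec ℕ p) : Set where
  field
    generates : ∀ s → S s ⇔ Generated gens s
    minimal   : ∀ (i : Fin p) →
                ¬ (Σ (Vec ℕ p) λ c → lookup c i ≡ 0 × lookup gens i ≡ value c gens)

record IsP {p : ℕ} (gens : Vec ℕ p) (s m : ℕ) : Set where
  field
    attained : Σ (Vec ℕ p) λ c → s ≡ value c gens × len c ≡ m
    maximal  : ∀ (c : Vec ℕ p) → s ≡ value c gens → len c ≤ m

-- ℓ_b(z): number of digits of z in base b (repeated division by b;
-- fuel z suffices since b > 1). ℓ_b(0) = 0 is irrelevant (only used for z > 0).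
digitsLen : (b : ℕ) → .{{NonZero b}} → ℕ → ℕ → ℕ
digitsLen b zero    z       = 0
digitsLen b (suc f) zero    = 0
digitsLen b (suc f) (suc z) = suc (digitsLen b f (suc z / b))

ℓ : (b : ℕ) → .{{NonZero b}} → ℕ → ℕ
ℓ b z = digitsLen b z z

record IsDigitalSemigroup (b : ℕ) .{{_ : NonZero b}} (D : Subset) : Set where
  field
    nonempty  : ∃ λ d → D d
    positive  : ∀ {d} → D d → 0 < d
    closed-*  : ∀ {x y} → D x → D y → D (x * y)
    digital   : ∀ {d z} → D d → 0 < z → ℓ b z ≡ ℓ b d → D z

-- S is a b-LD-semigroup (S is assumed to be a submonoid of (ℕ,+))
IsLDSemigroup : (b : ℕ) → .{{NonZero b}} → Subset → Set₁
IsLDSemigroup b S =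
  Σ Subset λ D → IsDigitalSemigroup b D ×
    (∀ n → S n ⇔ (n ≡ 0 ⊎ ∃ λ d → D d × ℓ b d ≡ n))

{-# OPTIONS --safe #-}
module Submission where

-- Put x ⊕ y = x + y − 1 on positive integers. S is a b-LD-semigroup iff
-- S ∖ {0} is closed under ⊕: if D realises S then b^a ∈ D whenever a + 1 ∈ S,
-- as ℓ_b(b^a) = a + 1, and b^a b^c = b^(a+c) has length (a + 1) ⊕ (c + 1);
-- conversely, since ℓ_b(xy) ∈ {ℓ_b x ⊕ ℓ_b y, ℓ_b x + ℓ_b y}, the set
-- D = {d > 0 : ℓ_b d ∈ S} is a digital semigroup realising S.
-- Closure under ⊕ is in turn equivalent to the condition on P(s). If
-- s = n_{i₁} + ⋯ + n_{i_m} with m = P(s), then for j < m the number s − j is the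
-- ⊕-combination of j + 1 of these generators plus the sum of the others.
-- Conversely, for positive x, y ∈ S the sum s = x + y has P(s) ≥ 2, so
-- x ⊕ y = s − 1 ∈ S.

open import Defs
open import Data.Nat
open import Data.Nat.Properties
open import Data.Nat.DivMod
open import Data.Fin using (zero; suc)
open import Data.Vec using (Vec; []; _∷_; lookup; zipWith; replicate; _[_]≔_)
open import Data.Vec.Properties using (lookup-replicate)
open import Data.Product using (Σ; ∃; _×_; _,_; proj₁; proj₂)
open import Data.Sum using (_⊎_; inj₁; inj₂; [_,_]′)
open import Function using (_∘_)
open import Function.Bundles using (_⇔_; mk⇔; Equivalence)
import Function.Properties.Equivalence as ⇔
open import Relation.Nullary using (¬_; Dec; yes; no)
open import Relation.Nullary.Decidable using (map′; _×-dec_)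
open import Relation.Unary using (Decidable)
open import Relation.Binary.PropositionalEquality
open import Data.Nat.Tactic.RingSolver using (solve-∀)

module Digits (b : ℕ) .{{_ : NonZero b}} (1<b : 1 < b) where

  digitsLen-0 : ∀ f → digitsLen b f 0 ≡ 0
  digitsLen-0 zero    = refl
  digitsLen-0 (suc f) = refl

  digitsLen-bracket : ∀ f z → 0 < z → z ≤ f →
                      ∃ λ k → digitsLen b f z ≡ suc k × b ^ k ≤ z × z < b ^ suc k
  digitsLen-bracket (suc f) (suc z) _ (s≤s z≤f)
    with suc z / b in q≡ | m/n<m (suc z) b 1<b
  ... | zero  | _ = 0 , cong suc (digitsLen-0 f) , s≤s z≤n ,
                    subst (suc z <_) (sym (*-identityʳ b)) (m/n≡0⇒m<n q≡)
  ... | suc q | q<z with digitsLen-bracket f (suc q) (s≤s z≤n) (≤-trans (≤-pred q<z) z≤f)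
  ...   | k , e , lo , hi = suc k , cong suc e , lo′ , hi′
    where
    open ≤-Reasoning
    lo′ : b * b ^ k ≤ suc z
    lo′ = begin
      b * b ^ k       ≤⟨ *-monoʳ-≤ b lo ⟩
      b * suc q       ≡⟨ *-comm b (suc q) ⟩
      suc q * b       ≡⟨ cong (_* b) q≡ ⟨
      suc z / b * b   ≤⟨ m/n*n≤m (suc z) b ⟩
      suc z           ∎
    hi′ : suc z < b * b ^ suc k
    hi′ = begin-strict
      suc z                     ≡⟨ m≡m%n+[m/n]*n (suc z) b ⟩
      suc z % b + suc z / b * b <⟨ +-monoˡ-< (suc z / b * b) (m%n<n (suc z) b) ⟩
      b + suc z / b * b         ≡⟨ cong (λ t → b + t * b) q≡ ⟩
      suc (suc q) * b           ≤⟨ *-monoˡ-≤ b hi ⟩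
      b ^ suc k * b             ≡⟨ *-comm (b ^ suc k) b ⟩
      b * b ^ suc k             ∎

  ℓ-bracket : ∀ {z} → 0 < z → ∃ λ k → ℓ b z ≡ suc k × b ^ k ≤ z × z < b ^ suc k
  ℓ-bracket {z} 0<z = digitsLen-bracket z z 0<z ≤-refl

  exponent-≤ : ∀ {m n z} → b ^ m ≤ z → z < b ^ suc n → m ≤ n
  exponent-≤ lo hi = ≮⇒≥ λ n<m → <⇒≱ hi (≤-trans (^-monoʳ-≤ b n<m) lo)

  ℓ-^ : ∀ k → ℓ b (b ^ k) ≡ suc k
  ℓ-^ k with ℓ-bracket (m^n>0 b k)
  ... | _ , ℓ≡ , lo , hi =
    trans ℓ≡ (cong suc (≤-antisym (exponent-≤ lo (^-monoʳ-< b 1<b (n<1+n k)))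
                                  (exponent-≤ ≤-refl hi)))

  ℓ-* : ∀ {x y a c} → b ^ a ≤ x → x < b ^ suc a → b ^ c ≤ y → y < b ^ suc c →
        ℓ b (x * y) ≡ suc (a + c) ⊎ ℓ b (x * y) ≡ suc a + suc c
  ℓ-* {x} {y} {a} {c} xlo xhi ylo yhi
    with ℓ-bracket (*-mono-< (<-≤-trans (m^n>0 b a) xlo) (<-≤-trans (m^n>0 b c) ylo))
  ... | k , ℓ≡ , lo , hi with m≤n⇒m<n∨m≡n (exponent-≤ lo′ hi)
    where
    lo′ : b ^ (a + c) ≤ x * y
    lo′ = subst (_≤ x * y) (sym (^-distribˡ-+-* b a c)) (*-mono-≤ xlo ylo)
  ...   | inj₂ a+c≡k = inj₁ (trans ℓ≡ (cong suc (sym a+c≡k)))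
  ...   | inj₁ a+c<k = inj₂ (trans ℓ≡ (cong suc (≤-antisym (exponent-≤ lo hi′) a+suc-c≤k)))
    where
    hi′ : x * y < b ^ (suc a + suc c)
    hi′ = subst (x * y <_) (sym (^-distribˡ-+-* b (suc a) (suc c))) (*-mono-< xhi yhi)
    a+suc-c≤k : a + suc c ≤ k
    a+suc-c≤k = subst (_≤ k) (sym (+-suc a c)) a+c<k

-- x ⊕ y = x + y − 1, written for x = suc a and y = suc c
ClosedUnder⊕ : Subset → Set
ClosedUnder⊕ S = ∀ {a c} → S (suc a) → S (suc c) → S (suc (a + c))

LengthIn : (b : ℕ) → .{{NonZero b}} → Subset → Subset
LengthIn b S d = 0 < d × S (ℓ b d)

module _ (b : ℕ) .{{_ : NonZero b}} (1<b : 1 < b) {S : Subset} where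
  open Digits b 1<b

  isLDSemigroup⇒closedUnder⊕ : IsLDSemigroup b S → ClosedUnder⊕ S
  isLDSemigroup⇒closedUnder⊕ (D , isDigital , S⇔) {a} {c} Sx Sy =
    Equivalence.from (S⇔ _) (inj₂ (b ^ (a + c) , b^[a+c]∈D , ℓ-^ (a + c)))
    where
    open IsDigitalSemigroup isDigital
    power∈D : ∀ {a} → S (suc a) → D (b ^ a)
    power∈D {a} Sa with Equivalence.to (S⇔ (suc a)) Sa
    ... | inj₂ (d , d∈D , ℓd≡) = digital d∈D (m^n>0 b a) (trans (ℓ-^ a) (sym ℓd≡))
    b^[a+c]∈D : D (b ^ (a + c))
    b^[a+c]∈D = subst D (sym (^-distribˡ-+-* b a c)) (closed-* (power∈D Sx) (power∈D Sy))

  closedUnder⊕⇒isLDSemigroup : IsNumericalMonoid S → ClosedUnder⊕ S → IsLDSemigroup b S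
  closedUnder⊕⇒isLDSemigroup nm ⊕-closed = LengthIn b S , isDigital , S⇔
    where
    open IsNumericalMonoid nm

    nonempty : ∃ (LengthIn b S)
    nonempty with cofinite
    ... | N , beyond = b ^ N , m^n>0 b N , subst S (sym (ℓ-^ N)) (beyond (suc N) (n≤1+n N))

    closed-* : ∀ {x y} → LengthIn b S x → LengthIn b S y → LengthIn b S (x * y)
    closed-* (0<x , Sℓx) (0<y , Sℓy) with ℓ-bracket 0<x | ℓ-bracket 0<y
    ... | a , ℓx≡ , xlo , xhi | c , ℓy≡ , ylo , yhi =
      *-mono-< 0<x 0<y ,
      [ (λ e → subst S (sym e) (⊕-closed Sa Sc)) , (λ e → subst S (sym e) (closed-+ Sa Sc)) ]′
        (ℓ-* xlo xhi ylo yhi)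
      where
      Sa : S (suc a)
      Sa = subst S ℓx≡ Sℓx
      Sc : S (suc c)
      Sc = subst S ℓy≡ Sℓy

    isDigital : IsDigitalSemigroup b (LengthIn b S)
    isDigital = record
      { nonempty = nonempty
      ; positive = proj₁
      ; closed-* = closed-*
      ; digital  = λ (_ , Sℓd) 0<z ℓz≡ℓd → 0<z , subst S (sym ℓz≡ℓd) Sℓd
      }

    S⇔ : ∀ n → S n ⇔ (n ≡ 0 ⊎ ∃ λ d → LengthIn b S d × ℓ b d ≡ n)
    S⇔ n = mk⇔ (to n) from
      where
      to : ∀ n → S n → n ≡ 0 ⊎ ∃ λ d → LengthIn b S d × ℓ b d ≡ n
      to zero    _  = inj₁ refl
      to (suc a) Sn = inj₂ (b ^ a , (m^n>0 b a , subst S (sym (ℓ-^ a)) Sn) , ℓ-^ a)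
      from : (n ≡ 0 ⊎ ∃ λ d → LengthIn b S d × ℓ b d ≡ n) → S n
      from (inj₁ refl)                 = has-zero
      from (inj₂ (d , (_ , Sℓd) , ℓd≡n)) = subst S ℓd≡n Sℓd

  isLDSemigroup⇔closedUnder⊕ : IsNumericalMonoid S → IsLDSemigroup b S ⇔ ClosedUnder⊕ S
  isLDSemigroup⇔closedUnder⊕ nm =
    mk⇔ isLDSemigroup⇒closedUnder⊕ (closedUnder⊕⇒isLDSemigroup nm)

Factorization : ∀ {p} → Vec ℕ p → ℕ → ℕ → Set
Factorization {p} gs s k = Σ (Vec ℕ p) λ c → s ≡ value c gs × len c ≡ k

value-replicate-0 : ∀ {p} (gs : Vec ℕ p) → value (replicate p 0) gs ≡ 0
value-replicate-0 []       = refl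
value-replicate-0 (_ ∷ gs) = value-replicate-0 gs

value-unit : ∀ {p} (gs : Vec ℕ p) i → value (replicate p 0 [ i ]≔ 1) gs ≡ lookup gs i
value-unit (g ∷ gs) zero    = trans (cong₂ _+_ (*-identityˡ g) (value-replicate-0 gs)) (+-identityʳ g)
value-unit (_ ∷ gs) (suc i) = value-unit gs i

len≡0⇒value≡0 : ∀ {p} (c gs : Vec ℕ p) → len c ≡ 0 → value c gs ≡ 0
len≡0⇒value≡0 []         []       _   = refl
len≡0⇒value≡0 (zero ∷ c) (_ ∷ gs) len≡0 = len≡0⇒value≡0 c gs len≡0

value-zipWith-+ : ∀ {p} (c d gs : Vec ℕ p) →
                  value (zipWith _+_ c d) gs ≡ value c gs + value d gs
value-zipWith-+ []      []      []       = refl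
value-zipWith-+ (x ∷ c) (y ∷ d) (g ∷ gs) =
  trans (cong ((x + y) * g +_) (value-zipWith-+ c d gs))
        (distribute x y g (value c gs) (value d gs))
  where
  distribute : ∀ x y g u v → (x + y) * g + (u + v) ≡ x * g + u + (y * g + v)
  distribute = solve-∀

len-zipWith-+ : ∀ {p} (c d : Vec ℕ p) → len (zipWith _+_ c d) ≡ len c + len d
len-zipWith-+ []      []      = refl
len-zipWith-+ (x ∷ c) (y ∷ d) =
  trans (cong (x + y +_) (len-zipWith-+ c d)) (+-assoc-comm x y (len c) (len d))
  where
  +-assoc-comm : ∀ x y u v → x + y + (u + v) ≡ x + u + (y + v)
  +-assoc-comm = solve-∀

len≤value : ∀ {p} (gs : Vec ℕ p) → (∀ i → 0 < lookup gs i) → ∀ c → len c ≤ value c gs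
len≤value []       _   []      = z≤n
len≤value (g ∷ gs) pos (x ∷ c) =
  +-mono-≤ (subst (_≤ x * g) (*-identityʳ x) (*-monoʳ-≤ x (pos zero)))
           (len≤value gs (pos ∘ suc) c)

factorization? : ∀ {p} (gs : Vec ℕ p) s k → Dec (Factorization gs s k)
factorization? []       s k = map′ (λ (s≡0 , k≡0) → [] , s≡0 , sym k≡0)
                                   (λ { ([] , s≡0 , 0≡k) → s≡0 , sym 0≡k })
                                   ((s ≟ 0) ×-dec (k ≟ 0))
factorization? (g ∷ gs) s k = map′ to from (anyUpTo? head? (suc k))
  where
  Head : ℕ → Set
  Head x = x * g ≤ s × x ≤ k × Factorization gs (s ∸ x * g) (k ∸ x)
  head? : Decidable Head
  head? x = (x * g ≤? s) ×-dec (x ≤? k) ×-dec factorization? gs (s ∸ x * g) (k ∸ x)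
  to : ∃ (λ x → x < suc k × Head x) → Factorization (g ∷ gs) s k
  to (x , _ , xg≤s , x≤k , c , s∸xg≡ , len≡k∸x) =
    x ∷ c , trans (sym (m+[n∸m]≡n xg≤s)) (cong (x * g +_) s∸xg≡) ,
            trans (cong (x +_) len≡k∸x) (m+[n∸m]≡n x≤k)
  from : Factorization (g ∷ gs) s k → ∃ (λ x → x < suc k × Head x)
  from (x ∷ c , s≡ , len≡k) =
    x , s≤s x≤k , subst (x * g ≤_) (sym s≡) (m≤m+n (x * g) (value c gs)) , x≤k ,
    c , trans (cong (_∸ x * g) s≡) (m+n∸m≡n (x * g) (value c gs)) ,
        sym (trans (cong (_∸ x) (sym len≡k)) (m+n∸m≡n x (len c)))
    where
    x≤k : x ≤ k
    x≤k = subst (x ≤_) len≡k (m≤m+n x (len c))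

∃-greatest : ∀ {P : ℕ → Set} → Decidable P → ∀ n → (∀ {k} → P k → k ≤ n) →
             ∀ {k₀} → P k₀ → ∃ λ m → P m × (∀ {k} → P k → k ≤ m)
∃-greatest P? zero    ≤n Pk₀ = _ , Pk₀ , λ Pk → ≤-trans (≤n Pk) z≤n
∃-greatest {P} P? (suc n) ≤1+n Pk₀ with P? (suc n)
... | yes P[1+n] = suc n , P[1+n] , ≤1+n
... | no ¬P[1+n] = ∃-greatest P? n ≤n Pk₀
  where
  ≤n : ∀ {k} → P k → k ≤ n
  ≤n Pk = ≤-pred (≤∧≢⇒< (≤1+n Pk) λ { refl → ¬P[1+n] Pk })

IsP-exists : ∀ {p} (gs : Vec ℕ p) → (∀ i → 0 < lookup gs i) →
             ∀ {s} → Generated gs s → ∃ (IsP gs s)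
IsP-exists gs pos {s} (c , s≡) with
  ∃-greatest (factorization? gs s) s
             (λ (c′ , s≡′ , len≡) → subst₂ _≤_ len≡ (sym s≡′) (len≤value gs pos c′))
             (c , s≡ , refl)
... | m , attained , greatest =
  m , record { attained = attained ; maximal = λ c′ s≡′ → greatest (c′ , s≡′ , refl) }

module _ {S : Subset} {p} {gens : Vec ℕ p} (msg : IsMinimalSystemOfGenerators S gens) where
  open IsMinimalSystemOfGenerators msg

  generator∈S : ∀ i → S (lookup gens i)
  generator∈S i = Equivalence.from (generates _) (replicate p 0 [ i ]≔ 1 , sym (value-unit gens i))

  generator-positive : ∀ i → 0 < lookup gens i
  generator-positive i = n≢0⇒n>0 λ gᵢ≡0 →
    minimal i (replicate p 0 , lookup-replicate i 0 , trans gᵢ≡0 (sym (value-replicate-0 gens)))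

  factorization-positive : ∀ {a} → S (suc a) → Σ (Vec ℕ p) λ c → suc a ≡ value c gens × 0 < len c
  factorization-positive Sx with Equivalence.to (generates _) Sx
  ... | c , x≡ = c , x≡ , n≢0⇒n>0 λ len≡0 → 1+n≢0 (trans x≡ (len≡0⇒value≡0 c gens len≡0))

-- s − j ∈ S ∖ {0} for every j < m, stated without truncated subtraction
Run : Subset → ℕ → ℕ → Set
Run S s m = ∀ j → j < m → ∃ λ r → S (suc r) × s ≡ j + suc r

module _ {S : Subset} (nm : IsNumericalMonoid S) (⊕-closed : ClosedUnder⊕ S) where
  open IsNumericalMonoid nm

  -- (g + s) − j = g ⊕ (s − (j − 1)) for j > 0
  run-+ : ∀ {g s m} → 0 < g → S g → S s → Run S s m → Run S (g + s) (suc m)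
  run-+ {suc a} {s} _ Sg Ss _   zero    _         = a + s , closed-+ Sg Ss , refl
  run-+ {suc a}     _ Sg _  run (suc j) (s≤s j<m) with run j j<m
  ... | r , Sr , s≡ = a + r , ⊕-closed Sg Sr ,
                      trans (cong (λ t → suc (a + t)) s≡) (shift a j r)
    where
    shift : ∀ a j r → suc (a + (j + suc r)) ≡ suc j + suc (a + r)
    shift = solve-∀

  run-* : ∀ {g s m} → 0 < g → S g → S s → Run S s m →
          ∀ x → S (x * g + s) × Run S (x * g + s) (x + m)
  run-* _   _  Ss run zero    = Ss , run
  run-* {g} {s} {m} 0<g Sg Ss run (suc x) with run-* 0<g Sg Ss run x
  ... | St , runₜ = subst (λ t → S t × Run S t (suc x + m)) (sym (+-assoc g (x * g) s))
                          (closed-+ Sg St , run-+ 0<g Sg St runₜ)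

  run-value : ∀ {p} (gs : Vec ℕ p) → (∀ i → 0 < lookup gs i) → (∀ i → S (lookup gs i)) →
              ∀ c → S (value c gs) × Run S (value c gs) (len c)
  run-value []       _   _   []      = has-zero , λ _ ()
  run-value (g ∷ gs) pos mem (x ∷ c) with run-value gs (pos ∘ suc) (mem ∘ suc) c
  ... | Sₜ , runₜ = run-* (pos zero) (mem zero) Sₜ runₜ x

ContainsShiftsBelowP : ∀ {p} → Subset → Vec ℕ p → Set
ContainsShiftsBelowP S gens =
  ∀ s → S s → ¬ (s ≡ 0) → ∀ m → IsP gens s m → ∀ j → j < m → S (s ∸ j)

module _ {S : Subset} (nm : IsNumericalMonoid S)
         {p} {gens : Vec ℕ p} (msg : IsMinimalSystemOfGenerators S gens) where
  open IsNumericalMonoid nm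

  closedUnder⊕⇒containsShiftsBelowP : ClosedUnder⊕ S → ContainsShiftsBelowP S gens
  closedUnder⊕⇒containsShiftsBelowP ⊕-closed s _ _ m isP j j<m with IsP.attained isP
  ... | c , s≡ , len≡m
    with proj₂ (run-value nm ⊕-closed gens (generator-positive msg) (generator∈S msg) c)
               j (subst (j <_) (sym len≡m) j<m)
  ... | r , Sr , value≡ =
    subst S (sym (trans (cong (_∸ j) (trans s≡ value≡)) (m+n∸m≡n j (suc r)))) Sr

  containsShiftsBelowP⇒closedUnder⊕ : ContainsShiftsBelowP S gens → ClosedUnder⊕ S
  containsShiftsBelowP⇒closedUnder⊕ shifts {a} {c} Sx Sy
    with factorization-positive msg Sx | factorization-positive msg Sy
  ... | cx , x≡ , 0<lx | cy , y≡ , 0<ly =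
    subst S (+-suc a c) (shifts _ (closed-+ Sx Sy) (λ ()) _ (proj₂ P[s]) 1 1<P[s])
    where
    cxy : Vec ℕ p
    cxy = zipWith _+_ cx cy
    s≡ : suc a + suc c ≡ value cxy gens
    s≡ = trans (cong₂ _+_ x≡ y≡) (sym (value-zipWith-+ cx cy gens))
    P[s] : ∃ (IsP gens (suc a + suc c))
    P[s] = IsP-exists gens (generator-positive msg) (cxy , s≡)
    1<P[s] : 1 < proj₁ P[s]
    1<P[s] = <-≤-trans (subst (1 <_) (sym (len-zipWith-+ cx cy)) (+-mono-≤ 0<lx 0<ly))
                       (IsP.maximal (proj₂ P[s]) cxy s≡)

  closedUnder⊕⇔containsShiftsBelowP : ClosedUnder⊕ S ⇔ ContainsShiftsBelowP S gens
  closedUnder⊕⇔containsShiftsBelowP =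
    mk⇔ closedUnder⊕⇒containsShiftsBelowP containsShiftsBelowP⇒closedUnder⊕

proposition4p2 : (b : ℕ) .{{_ : NonZero b}} → 1 < b →
    (S : Subset) → IsNumericalMonoid S →
    (p : ℕ) (gens : Vec ℕ p) → IsMinimalSystemOfGenerators S gens →
    IsLDSemigroup b S ⇔
      (∀ s → S s → ¬ (s ≡ 0) → ∀ m → IsP gens s m → ∀ j → j < m → S (s ∸ j))
proposition4p2 b 1<b S nm p gens msg =
  ⇔.trans (isLDSemigroup⇔closedUnder⊕ b 1<b nm) (closedUnder⊕⇔containsShiftsBelowP nm msg)
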